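{- Let $\mathfrak{A}$ be a $2$-data structure over $\Sigma$ and let $\mathfrak{A}^{+\mathsf{ge}}=(A',(P'_\sigma),f'_1,f'_2)$. Then for every $a\in A'$, the $3$-view of $\mathfrak{A}^{+\mathsf{ge}}$ around $a$ (with respect to $\{\sim_{(1,1)},\sim_{(2,2)}\}$) equals $\mathfrak{A}^{+\mathsf{ge}}$.
   Context: A $2$-data structure over a finite set $\Sigma$ of unary predicates is $\mathfrak{A}=(A,(P_\sigma)_{\sigma\in\Sigma},f_1,f_2)$, $A$ nonempty finite, $P_\sigma\subseteq A$, $f_1,f_2:A\to\mathbb{N}$. Let $V=\{f_i(a):a\in A,i\in\{1,2\}\}$ and $\mathsf{ge}\notin\Sigma$ a fresh unary predicate. $\mathfrak{A}^{+\mathsf{ge}}$ is the $2$-data structure over $\Sigma\cup\{\mathsf{ge}\}$ with universe $A'=A\uplus(V\times V)$, $f'_i(a)=f_i(a)$ for $a\in A$, $f'_i((d_1,d_2))=d_i$ for $(d_1,d_2)\in V\times V$, $P'_\sigma=P_\sigma$ for $\sigma\in\Sigma$, and $P'_\mathsf{ge}=V\times V$. With $\Gamma=\{\sim_{(1,1)},\sim_{(2,2)}\}$ the data graph of a $2$-data structure has vertices (element, index) and a directed edge $(a,i)\to(b,j)$ iff ($a=b$, $i\ne j$) or ($i=j$ and the $i$-th values of $a$ and $b$ coincide). $B_r(a)$ is the set of vertices at directed distance $\le r$ from $(a,1)$ or $(a,2)$. The $r$-view around $a$ has universe $\{b:(b,i)\in B_r(a)$ for some $i\}$, restricted predicates,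 and $i$-th value of $b$ equal to its original one if $(b,i)\in B_r(a)$, otherwise a fresh value. -}

module Defs where

open import Data.Nat using (ℕ; zero; suc; NonZero; _≡ᵇ_)
open import Data.Fin using (Fin; zero; suc)
open import Data.Bool using (Bool; true; false; _∧_; T)
open import Data.List using (List; []; _∷_; concatMap; allFin)
open import Data.Bool.ListAction using (any)
open import Data.Product using (Σ; _×_; _,_; proj₁; proj₂; ∃)
open import Data.Sum using (_⊎_; inj₁; inj₂)
open import Relation.Binary.PropositionalEquality using (_≡_; _≢_)
open import Relation.Nullary using (¬_)

record TwoDataStructure (k : ℕ) : Set where
  field
    n        : ℕ
    nonempty : NonZero n
    P        : Fin k → Fin n → Bool
    f        : Fin 2 → Fin n → ℕ        -- f zero = f₁, f (suc zero) = f₂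

record DataStr (k : ℕ) : Set₁ where
  field
    Carrier : Set
    P       : Fin k → Carrier → Bool
    val     : Fin 2 → Carrier → ℕ

module PlusGe {k : ℕ} (𝔄 : TwoDataStructure k) where
  open TwoDataStructure 𝔄

  values : List ℕ
  values = concatMap (λ a → f zero a ∷ f (suc zero) a ∷ []) (allFin n)

  inV : ℕ → Bool
  inV d = any (d ≡ᵇ_) values

  -- V × V (membership proof is T of a boolean, hence proof-irrelevant)
  VxV : Set
  VxV = Σ (ℕ × ℕ) (λ p → T (inV (proj₁ p) ∧ inV (proj₂ p)))

  Carrier' : Set
  Carrier' = Fin n ⊎ VxV

  -- predicate index zero is the fresh predicate ge; suc σ is σ ∈ Σ
  P' : Fin (suc k) → Carrier' → Bool
  P' zero    (inj₁ _) = false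
  P' zero    (inj₂ _) = true
  P' (suc σ) (inj₁ a) = P σ a
  P' (suc σ) (inj₂ _) = false

  val' : Fin 2 → Carrier' → ℕ
  val' i (inj₁ a) = f i a
  val' zero (inj₂ ((d₁ , d₂) , _)) = d₁
  val' (suc zero) (inj₂ ((d₁ , d₂) , _)) = d₂

  structure : DataStr (suc k)
  structure = record { Carrier = Carrier' ; P = P' ; val = val' }

_⁺ᵍᵉ : {k : ℕ} → TwoDataStructure k → DataStr (suc k)
𝔄 ⁺ᵍᵉ = PlusGe.structure 𝔄

module DataGraph {k : ℕ} (D : DataStr k) where
  open DataStr D

  Vertex : Set
  Vertex = Carrier × Fin 2

  -- edges of the data graph w.r.t. Γ = {∼(1,1), ∼(2,2)}
  Edge : Vertex → Vertex → Set
  Edge (a , i) (b , j) = (a ≡ b × i ≢ j) ⊎ (i ≡ j × val i a ≡ val i b)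

  -- directed path of length ≤ r
  data Path : ℕ → Vertex → Vertex → Set where
    here : ∀ {r u} → Path r u u
    step : ∀ {r u w v} → Edge u w → Path r w v → Path (suc r) u v

  InBall : ℕ → Carrier → Vertex → Set
  InBall r a v = Path r (a , zero) v ⊎ Path r (a , suc zero) v

  InViewUniverse : ℕ → Carrier → Carrier → Set
  InViewUniverse r a b = ∃ λ i → InBall r a (b , i)

  -- the i-th value of b in the r-view around a: the original value
  -- (inj₁) if (b,i) ∈ B_r(a), otherwise a fresh value (inj₂ (b , i)),
  -- distinct from all natural-number values and from each other.
  data ViewVal (r : ℕ) (a b : Carrier) (i : Fin 2) : ℕ ⊎ Vertex → Set where
    original : InBall r a (b , i) → ViewVal r a b i (inj₁ (val i b))
    fresh    : ¬ InBall r a (b , i) → ViewVal r a b i (inj₂ (b , i))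

  -- the predicates of the view are those of D restricted to its universe,
  -- so the r-view around a equals D iff its universe is everything and
  -- every value of the view is the original one.
  ViewEqualsWhole : ℕ → Carrier → Set
  ViewEqualsWhole r a =
    ((b : Carrier) → InViewUniverse r a b) ×
    ((b : Carrier) (i : Fin 2) (v : ℕ ⊎ Vertex) → ViewVal r a b i v → v ≡ inj₁ (val i b))

-- For data values v₁, v₂ the element g = (v₁ , v₂) of V × V links the two coordinates:
-- (x , 1) → (g , 1) → (g , 2) → (y , 2) is a path whenever f₁ x = v₁ and f₂ y = v₂.
-- Every data value lies in V, so from some coordinate of any a each vertex (b , i) is
-- reached in three steps through a suitable g. Hence the 3-ball around a is the whole
-- data graph, and the 3-view keeps every element and every value.
{-# OPTIONS --safe #-}
module Submission where

open import Defs
open import Data.Nat using (ℕ; _≡ᵇ_)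
open import Data.Nat.Properties using (≡⇒≡ᵇ)
open import Data.Fin using (zero; suc)
open import Data.Bool using (T)
open import Data.Bool.Properties using (T-∧)
open import Data.List using (_∷_; [])
open import Data.List.Membership.Propositional using (_∈_)
open import Data.List.Membership.Propositional.Properties using (∈-allFin; ∈-map⁺; ∈-concat⁺′)
open import Data.List.Relation.Unary.Any using (here; there)
import Data.List.Relation.Unary.Any as Any
open import Data.List.Relation.Unary.Any.Properties using (any⁺)
open import Data.Product using (_×_; _,_; proj₁; proj₂; ∃)
open import Data.Sum using (inj₁; inj₂)
open import Function using (Equivalence)
open import Relation.Binary.PropositionalEquality using (_≡_; _≢_; refl; sym)
open import Relation.Nullary using (contradiction)

module _ {k : ℕ} (D : DataStr k) where
  open DataStr D
  open DataGraph D

  RealisesValuePairs : Set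
  RealisesValuePairs =
    (a b : Carrier) → ∃ λ g → val zero g ≡ val zero a × val (suc zero) g ≡ val (suc zero) b

  path-via : ∀ {a b i j} (g : Carrier) → j ≢ i →
             val j a ≡ val j g → val i g ≡ val i b → Path 3 (a , j) (b , i)
  path-via g j≢i a∼g g∼b =
    step (inj₂ (refl , a∼g)) (step (inj₁ (refl , j≢i)) (step (inj₂ (refl , g∼b)) here))

  realisesValuePairs⇒ball₃-full : RealisesValuePairs →
                                  ∀ a b i → InBall 3 a (b , i)
  realisesValuePairs⇒ball₃-full realise a b zero
    with g , g₁≡b₁ , g₂≡a₂ ← realise b a
    = inj₂ (path-via g (λ ()) (sym g₂≡a₂) g₁≡b₁)
  realisesValuePairs⇒ball₃-full realise a b (suc zero)
    with g , g₁≡a₁ , g₂≡b₂ ← realise a b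
    = inj₁ (path-via g (λ ()) (sym g₁≡a₁) g₂≡b₂)

  fullBall⇒viewEqualsWhole : ∀ r a → (∀ b i → InBall r a (b , i)) → ViewEqualsWhole r a
  fullBall⇒viewEqualsWhole r a full = (λ b → zero , full b zero) , keepsValues
    where
    keepsValues : ∀ b i v → ViewVal r a b i v → v ≡ inj₁ (val i b)
    keepsValues b i _ (original _)   = refl
    keepsValues b i _ (fresh ¬inBall) = contradiction (full b i) ¬inBall

module _ {k : ℕ} (𝔄 : TwoDataStructure k) where
  open TwoDataStructure 𝔄
  open PlusGe 𝔄

  f-∈-values : ∀ i a → f i a ∈ values
  f-∈-values i a = ∈-concat⁺′ (f-∈-pair i) (∈-map⁺ (λ a → f zero a ∷ f (suc zero) a ∷ []) (∈-allFin a))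
    where
    f-∈-pair : ∀ i → f i a ∈ f zero a ∷ f (suc zero) a ∷ []
    f-∈-pair zero       = here refl
    f-∈-pair (suc zero) = there (here refl)

  ∈-values⇒inV : ∀ {d} → d ∈ values → T (inV d)
  ∈-values⇒inV {d} d∈values = any⁺ (d ≡ᵇ_) (Any.map (≡⇒≡ᵇ d _) d∈values)

  inV-val' : ∀ i c → T (inV (val' i c))
  inV-val' i          (inj₁ a)             = ∈-values⇒inV (f-∈-values i a)
  inV-val' zero       (inj₂ (_ , d₁d₂∈V)) = proj₁ (Equivalence.to T-∧ d₁d₂∈V)
  inV-val' (suc zero) (inj₂ (_ , d₁d₂∈V)) = proj₂ (Equivalence.to T-∧ d₁d₂∈V)

  plusGe-realisesValuePairs : RealisesValuePairs (𝔄 ⁺ᵍᵉ)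
  plusGe-realisesValuePairs a b =
    inj₂ ((val' zero a , val' (suc zero) b) ,
          Equivalence.from T-∧ (inV-val' zero a , inV-val' (suc zero) b)) ,
    refl , refl

lemma4p11 : {k : ℕ} (𝔄 : TwoDataStructure k) (a : DataStr.Carrier (𝔄 ⁺ᵍᵉ)) →
    DataGraph.ViewEqualsWhole (𝔄 ⁺ᵍᵉ) 3 a
lemma4p11 𝔄 a =
  fullBall⇒viewEqualsWhole (𝔄 ⁺ᵍᵉ) 3 a
    (realisesValuePairs⇒ball₃-full (𝔄 ⁺ᵍᵉ) (plusGe-realisesValuePairs 𝔄) a)
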